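{- $b(Q_7^5)\le 2^6+9$.
   Context: The hypercube $Q_n$ has vertex set the power set $2^{[n]}$ of $[n]=\{1,\dots,n\}$, with $x,y$ adjacent iff $|x\triangle y|=1$. The $p$-th power $Q_n^p$ has the same vertex set, with distinct $x,y$ adjacent iff $|x\triangle y|\le p$. A b-coloring of a graph $G$ with $k$ colors is a proper vertex coloring with $k$ colors in which every color class contains a vertex adjacent to at least one vertex of every other color class; the b-chromatic number $b(G)$ is the largest $k$ for which $G$ has a b-coloring with $k$ colors. -}

module Defs where

open import Data.Nat using (ℕ; _≤_)
open import Data.Fin using (Fin)
open import Data.Fin.Subset using (Subset; _∪_; _─_; ∣_∣)
open import Data.Product using (Σ; _×_)
open import Relation.Binary.PropositionalEquality using (_≡_; _≢_)

_△_ : ∀ {n} → Subset n → Subset n → Subset n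
x △ y = (x ─ y) ∪ (y ─ x)

-- Adjacency in the p-th power Q_n^p of the hypercube Q_n:
-- vertices are subsets of [n]; distinct x, y adjacent iff |x △ y| ≤ p.
QAdj : (n p : ℕ) → Subset n → Subset n → Set
QAdj n p x y = (x ≢ y) × (∣ x △ y ∣ ≤ p)

IsBColoring : {V : Set} → (V → V → Set) → (k : ℕ) → (V → Fin k) → Set
IsBColoring {V} Adj k c =
  (∀ x y → Adj x y → c x ≢ c y) ×
  (∀ (i : Fin k) → Σ V λ v → (c v ≡ i) ×
      (∀ (j : Fin k) → j ≢ i → Σ V λ w → Adj v w × (c w ≡ j)))

-- b(G) ≤ m : every b-coloring of G uses at most m colors
-- (b(G) is the largest such k, so this is exactly b(G) ≤ m).
bChromatic≤ : {V : Set} → (V → V → Set) → ℕ → Set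
bChromatic≤ {V} Adj m = ∀ (k : ℕ) (c : V → Fin k) → IsBColoring Adj k c → k ≤ m

-- In Q₇⁵ two vertices of the same colour are at distance at least 6, so no three
-- share a colour: every class is a single vertex or a pair {v, mate v}. A b-vertex
-- sees every singleton class, so it lies within distance 5 of each singleton vertex.
-- Counting the k b-vertices together with the mates of the non-singleton ones gives
-- at least 2k − 128 singletons, i.e. at least 20 when k ≥ 74. A vertex within
-- distance 1 of the complement of a singleton u is at distance at least 6 from u,
-- hence is not a b-vertex while its mate is. Vertex isoperimetry in Q₇, computed by
-- splitting on the first coordinate, puts at least 57 vertices that close to the
-- complements of 20 singletons; with their mates and the 20 singletons these are
-- 134 > 2⁷ distinct vertices.

module Submission where

open import Defs
open import Data.Bool using (Bool; true; false; not)
import Data.Bool.Properties as Bool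
open import Data.Empty using (⊥; ⊥-elim)
open import Data.Fin using (Fin)
import Data.Fin.Properties as Fin
open import Data.Fin.Subset using (Subset; ∁; ∣_∣)
open import Data.List using (List; []; _∷_; _++_; map; filter; length; take; allFin; applyUpTo)
open import Data.List.Properties using (filter-notAll; length-map; length-++; length-take; length-tabulate)
open import Data.List.Membership.Propositional using (_∈_; find; lose)
open import Data.List.Membership.Propositional.Properties using (∈-filter⁺; ∈-map⁺; ∈-++⁺ˡ; ∈-++⁺ʳ)
open import Data.List.Relation.Binary.Disjoint.Propositional using (Disjoint)
open import Data.List.Relation.Unary.All as All using (All; []; _∷_)
import Data.List.Relation.Unary.All.Properties as All
open import Data.List.Relation.Unary.Any as Any using (Any; here; there)
import Data.List.Relation.Unary.Any.Properties as Any
open import Data.List.Relation.Unary.AllPairs using ([]; _∷_)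
open import Data.List.Relation.Unary.Unique.Propositional using (Unique)
import Data.List.Relation.Unary.Unique.Propositional.Properties as Unique
open import Data.Nat using (ℕ; zero; suc; _+_; _^_; _*_; _∸_; _⊓_; _⊔_; _≤_; _<_; z≤n; s≤s; s≤s⁻¹; _≤?_; _<?_)
open import Data.Nat.Properties
open import Data.Nat.Tactic.RingSolver using (solve-∀)
open import Data.Product using (Σ; _×_; _,_; proj₁; proj₂)
open import Data.Sum using (_⊎_; inj₁; inj₂; [_,_])
open import Data.Vec using ([]; _∷_; head)
import Data.Vec.Properties as Vec
open import Function using (_∘_; id)
open import Function.Definitions using (Injective)
open import Relation.Binary.Definitions using (DecidableEquality)
open import Relation.Binary.PropositionalEquality hiding ([_])
open import Relation.Nullary using (¬_; Dec; yes; no; ¬?)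
open import Relation.Nullary.Decidable using (_×-dec_; from-yes)
open import Relation.Unary using (Decidable)
open import Relation.Unary.Properties using (∁?)

private
  variable
    A B : Set
    n : ℕ

△-self : (x : Subset n) → ∣ x △ x ∣ ≡ 0
△-self []          = refl
△-self (true ∷ x)  = △-self x
△-self (false ∷ x) = △-self x

△-cons : ∀ b (x y : Subset n) → ∣ (b ∷ x) △ (b ∷ y) ∣ ≡ ∣ x △ y ∣
△-cons true  x y = refl
△-cons false x y = refl

△-cons-not : ∀ b (x : Subset n) → ∣ (b ∷ x) △ (not b ∷ x) ∣ ≡ 1
△-cons-not true  x = cong suc (△-self x)
△-cons-not false x = cong suc (△-self x)

△-cons-split : ∀ a b (x y : Subset n) → ∣ (a ∷ x) △ (b ∷ y) ∣ ≡ ∣ (a ∷ []) △ (b ∷ []) ∣ + ∣ x △ y ∣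
△-cons-split true  true  x y = refl
△-cons-split true  false x y = refl
△-cons-split false true  x y = refl
△-cons-split false false x y = refl

△-∁ : (y u : Subset n) → ∣ y △ ∁ u ∣ + ∣ y △ u ∣ ≡ n
△-∁ []          []          = refl
△-∁ (true ∷ y)  (true ∷ u)  = cong suc (△-∁ y u)
△-∁ (false ∷ y) (false ∷ u) = cong suc (△-∁ y u)
△-∁ (true ∷ y)  (false ∷ u) = trans (+-suc _ _) (cong suc (△-∁ y u))
△-∁ (false ∷ y) (true ∷ u)  = trans (+-suc _ _) (cong suc (△-∁ y u))

∁-near⇒far : (y u : Subset n) → ∣ y △ ∁ u ∣ ≤ 1 → n ≤ suc ∣ y △ u ∣
∁-near⇒far {n} y u y~∁u = begin
  n                           ≡⟨ △-∁ y u ⟨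
  ∣ y △ ∁ u ∣ + ∣ y △ u ∣     ≤⟨ +-monoˡ-≤ ∣ y △ u ∣ y~∁u ⟩
  suc ∣ y △ u ∣               ∎
  where open ≤-Reasoning

-- Each coordinate contributes 0 or 2 to the sum.
△-perimeter : (x y z : Subset n) → ∣ x △ y ∣ + ∣ y △ z ∣ + ∣ x △ z ∣ ≤ 2 * n
△-perimeter [] [] [] = z≤n
△-perimeter {suc n} (a ∷ x) (b ∷ y) (c ∷ z) = begin
  ∣ (a ∷ x) △ (b ∷ y) ∣ + ∣ (b ∷ y) △ (c ∷ z) ∣ + ∣ (a ∷ x) △ (c ∷ z) ∣
    ≡⟨ cong₂ _+_ (cong₂ _+_ (△-cons-split a b x y) (△-cons-split b c y z)) (△-cons-split a c x z) ⟩
  (d a b + ∣ x △ y ∣) + (d b c + ∣ y △ z ∣) + (d a c + ∣ x △ z ∣)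
    ≡⟨ regroup (d a b) (d b c) (d a c) _ _ _ ⟩
  (d a b + d b c + d a c) + (∣ x △ y ∣ + ∣ y △ z ∣ + ∣ x △ z ∣)
    ≤⟨ +-mono-≤ (perimeter₁ a b c) (△-perimeter x y z) ⟩
  2 + 2 * n
    ≡⟨ sym (*-distribˡ-+ 2 1 n) ⟩
  2 * suc n ∎
  where
  open ≤-Reasoning

  d : Bool → Bool → ℕ
  d a b = ∣ (a ∷ []) △ (b ∷ []) ∣

  perimeter₁ : ∀ a b c → d a b + d b c + d a c ≤ 2
  perimeter₁ true  true  true  = z≤n
  perimeter₁ false false false = z≤n
  perimeter₁ true  true  false = ≤-refl
  perimeter₁ true  false true  = ≤-refl
  perimeter₁ true  false false = ≤-refl
  perimeter₁ false true  true  = ≤-refl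
  perimeter₁ false true  false = ≤-refl
  perimeter₁ false false true  = ≤-refl

  regroup : ∀ p q r s t u → (p + s) + (q + t) + (r + u) ≡ (p + q + r) + (s + t + u)
  regroup = solve-∀

module _ (_≟_ : DecidableEquality A) where

  unique-⊆⇒length≤ : {xs ys : List A} → Unique xs → (∀ {x} → x ∈ xs → x ∈ ys) → length xs ≤ length ys
  unique-⊆⇒length≤ {[]}     _          _  = z≤n
  unique-⊆⇒length≤ {x ∷ xs} {ys} (x∉xs ∷ u) xs⊆ys =
    ≤-trans (s≤s (unique-⊆⇒length≤ u xs⊆ys-x)) (filter-notAll ≢x? ys (Any.map (λ x≡y y≢x → y≢x (sym x≡y)) (xs⊆ys (here refl))))
    where
    ≢x? : Decidable (_≢ x)
    ≢x? y = ¬? (y ≟ x)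

    xs⊆ys-x : ∀ {y} → y ∈ xs → y ∈ filter ≢x? ys
    xs⊆ys-x y∈xs = ∈-filter⁺ ≢x? (xs⊆ys (there y∈xs)) (λ y≡x → All.lookup x∉xs y∈xs (sym y≡x))

exclusive⇒disjoint : {P Q : A → Set} → (∀ {x} → P x → Q x → ⊥) →
                     {xs ys : List A} → All P xs → All Q ys → Disjoint xs ys
exclusive⇒disjoint excl ps qs (x∈xs , x∈ys) = excl (All.lookup ps x∈xs) (All.lookup qs x∈ys)

length-filter+length-filter-∁ : {P : A → Set} (P? : Decidable P) (xs : List A) →
                                length (filter P? xs) + length (filter (∁? P?) xs) ≡ length xs
length-filter+length-filter-∁ P? []       = refl
length-filter+length-filter-∁ P? (x ∷ xs) with P? x
... | yes _ = cong suc (length-filter+length-filter-∁ P? xs)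
... | no  _ = trans (+-suc _ _) (cong suc (length-filter+length-filter-∁ P? xs))

record AtLeast {A : Set} (P : A → Set) (m : ℕ) : Set where
  constructor atLeast
  field
    elements : List A
    unique   : Unique elements
    all      : All P elements
    size     : m ≤ length elements

module _ {P : A → Set} where

  AtLeast-weaken : ∀ {m m′} → m ≤ m′ → AtLeast P m′ → AtLeast P m
  AtLeast-weaken m≤m′ (atLeast xs u ps s) = atLeast xs u ps (≤-trans m≤m′ s)

  AtLeast-⊔ : ∀ {a b} → AtLeast P a → AtLeast P b → AtLeast P (a ⊔ b)
  AtLeast-⊔ {a} {b} (atLeast xs ux px sx) (atLeast ys uy py sy) with a ≤? b
  ... | yes a≤b = atLeast ys uy py (⊔-lub (≤-trans a≤b sy) sy)
  ... | no  a≰b = atLeast xs ux px (⊔-lub sx (≤-trans (<⇒≤ (≰⇒> a≰b)) sx))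

  AtLeast-∪ : {Q : A → Set} → (∀ {x} → P x → Q x → ⊥) → ∀ {a b} → AtLeast P a → AtLeast Q b → AtLeast (λ x → P x ⊎ Q x) (a + b)
  AtLeast-∪ excl (atLeast xs ux px sx) (atLeast ys uy qy sy) = atLeast (xs ++ ys)
    (Unique.++⁺ ux uy (exclusive⇒disjoint excl px qy))
    (All.++⁺ (All.map inj₁ px) (All.map inj₂ qy))
    (subst (_ ≤_) (sym (length-++ xs)) (+-mono-≤ sx sy))

  AtLeast-map : {Q : B → Set} (f : A → B) → Injective _≡_ _≡_ f → (∀ {x} → P x → Q (f x)) →
                ∀ {m} → AtLeast P m → AtLeast Q m
  AtLeast-map f f-inj P⇒Q (atLeast xs u ps s) =
    atLeast (map f xs) (Unique.map⁺ f-inj u) (All.map⁺ (All.map P⇒Q ps)) (subst (_ ≤_) (sym (length-map f xs)) s)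

AtLeast-filter : {P : A → Set} (P? : Decidable P) {xs : List A} → Unique xs → AtLeast P (length (filter P? xs))
AtLeast-filter P? {xs} u = atLeast (filter P? xs) (Unique.filter⁺ P? u) (All.all-filter P? xs) ≤-refl

_≟ˢ_ : DecidableEquality (Subset n)
_≟ˢ_ = Vec.≡-dec Bool._≟_

∁-injective : Injective _≡_ _≡_ (∁ {n})
∁-injective {x = []}    {[]}    _ = refl
∁-injective {x = _ ∷ _} {_ ∷ _} e =
  cong₂ _∷_ (Bool.not-injective (Vec.∷-injectiveˡ e)) (∁-injective (Vec.∷-injectiveʳ e))

allSubsets : ∀ n → List (Subset n)
allSubsets zero    = [] ∷ []
allSubsets (suc n) = map (true ∷_) (allSubsets n) ++ map (false ∷_) (allSubsets n)

∈-allSubsets : (x : Subset n) → x ∈ allSubsets n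
∈-allSubsets []                = here refl
∈-allSubsets (true ∷ x)        = ∈-++⁺ˡ (∈-map⁺ (true ∷_) (∈-allSubsets x))
∈-allSubsets {suc n} (false ∷ x) = ∈-++⁺ʳ (map (true ∷_) (allSubsets n)) (∈-map⁺ (false ∷_) (∈-allSubsets x))

length-allSubsets : ∀ n → length (allSubsets n) ≡ 2 ^ n
length-allSubsets zero    = refl
length-allSubsets (suc n) = begin
  length (map (true ∷_) (allSubsets n) ++ map (false ∷_) (allSubsets n))
    ≡⟨ length-++ (map (true ∷_) (allSubsets n)) ⟩
  length (map (true ∷_) (allSubsets n)) + length (map (false ∷_) (allSubsets n))
    ≡⟨ cong₂ _+_ (length-map (true ∷_) (allSubsets n)) (length-map (false ∷_) (allSubsets n)) ⟩
  length (allSubsets n) + length (allSubsets n)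
    ≡⟨ cong (λ m → m + m) (length-allSubsets n) ⟩
  2 ^ n + 2 ^ n
    ≡⟨ cong (2 ^ n +_) (sym (+-identityʳ (2 ^ n))) ⟩
  2 ^ suc n ∎
  where open ≡-Reasoning

AtLeast⇒≤2^n : {P : Subset n → Set} → ∀ {m} → AtLeast P m → m ≤ 2 ^ n
AtLeast⇒≤2^n {n} (atLeast xs u _ s) = begin
  _             ≤⟨ s ⟩
  length xs     ≤⟨ unique-⊆⇒length≤ _≟ˢ_ u (λ {x} _ → ∈-allSubsets x) ⟩
  length (allSubsets n) ≡⟨ length-allSubsets n ⟩
  2 ^ n ∎
  where open ≤-Reasoning

AtLeast-split : {P : Subset (suc n) → Set} → ∀ {a b} →
                AtLeast (P ∘ (true ∷_)) a → AtLeast (P ∘ (false ∷_)) b → AtLeast P (a + b)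
AtLeast-split {P = P} X Y =
  AtLeast-map id id [ proj₁ , proj₁ ]
    (AtLeast-∪ heads-differ (AtLeast-map (true ∷_) Vec.∷-injectiveʳ (_, refl) X)
                            (AtLeast-map (false ∷_) Vec.∷-injectiveʳ (_, refl) Y))
  where
  HeadIs : Bool → Subset (suc _) → Set
  HeadIs b x = P x × head x ≡ b

  heads-differ : ∀ {x} → HeadIs true x → HeadIs false x → ⊥
  heads-differ (_ , h≡true) (_ , h≡false) with trans (sym h≡true) h≡false
  ... | ()

-- Vertex isoperimetry in the cube

Near : List (Subset n) → Subset n → Set
Near T y = Any (λ t → ∣ y △ t ∣ ≤ 1) T

slice : Bool → List (Subset (suc n)) → List (Subset n)
slice b []            = []
slice b ((a ∷ x) ∷ T) with a Bool.≟ b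
... | yes _ = x ∷ slice b T
... | no  _ = slice b T

∈-slice⁻ : ∀ b (T : List (Subset (suc n))) {x} → x ∈ slice b T → (b ∷ x) ∈ T
∈-slice⁻ b ((a ∷ x) ∷ T) x∈ with a Bool.≟ b | x∈
... | yes refl | here refl = here refl
... | yes refl | there x∈′ = there (∈-slice⁻ b T x∈′)
... | no  _    | x∈′       = there (∈-slice⁻ b T x∈′)

slice-unique : ∀ b {T : List (Subset (suc n))} → Unique T → Unique (slice b T)
slice-unique b {[]}          _          = []
slice-unique b {(a ∷ x) ∷ T} (x∉T ∷ u) with a Bool.≟ b
... | yes refl = All.tabulate (λ y∈ x≡y → All.lookup x∉T (∈-slice⁻ b T y∈) (cong (b ∷_) x≡y)) ∷ slice-unique b u
... | no  _    = slice-unique b u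

length-slices : (T : List (Subset (suc n))) → length T ≡ length (slice true T) + length (slice false T)
length-slices []                = refl
length-slices ((true ∷ x) ∷ T)  = cong suc (length-slices T)
length-slices ((false ∷ x) ∷ T) = trans (cong suc (length-slices T)) (sym (+-suc _ _))

slice-near : ∀ b {T : List (Subset (suc n))} {x} → Near (slice b T) x → Near T (b ∷ x)
slice-near b {T} {x} near with find near
... | t , t∈ , x~t = lose (∈-slice⁻ b T t∈) (subst (_≤ 1) (sym (△-cons b x t)) x~t)

slice-not-near : ∀ b {T : List (Subset (suc n))} {x} → x ∈ slice (not b) T → Near T (b ∷ x)
slice-not-near b {T} {x} x∈ = lose (∈-slice⁻ (not b) T x∈) (≤-reflexive (△-cons-not b x))

indexOr0 : List ℕ → ℕ → ℕ
indexOr0 []       _       = 0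
indexOr0 (x ∷ xs) zero    = x
indexOr0 (x ∷ xs) (suc m) = indexOr0 xs m

-- Memoises f on [0, w); the junk value 0 beyond w is still a lower bound.
cacheUpTo : ℕ → (ℕ → ℕ) → ℕ → ℕ
cacheUpTo w f = indexOr0 (applyUpTo f w)

cacheUpTo-≤ : ∀ w f m → cacheUpTo w f m ≤ f m
cacheUpTo-≤ zero    f m       = z≤n
cacheUpTo-≤ (suc w) f zero    = ≤-refl
cacheUpTo-≤ (suc w) f (suc m) = cacheUpTo-≤ w (f ∘ suc) m

minUpTo : (ℕ → ℕ) → ℕ → ℕ
minUpTo f zero    = f 0
minUpTo f (suc m) = minUpTo f m ⊓ f (suc m)

minUpTo-≤ : ∀ f {a} m → a ≤ m → minUpTo f m ≤ f a
minUpTo-≤ f zero z≤n = ≤-refl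
minUpTo-≤ f (suc m) a≤1+m with m≤n⇒m<n∨m≡n a≤1+m
... | inj₁ (s≤s a≤m) = ≤-trans (m⊓n≤m _ _) (minUpTo-≤ f m a≤m)
... | inj₂ refl      = m⊓n≤n _ _

-- If a of the vertices start with true and b with false, the true half of their
-- neighbourhood contains the lifted neighbourhood of the a vertices and the b vertices
-- moved across; symmetrically for the false half.
splitCost : (ℕ → ℕ) → ℕ → ℕ → ℕ
splitCost g a b = (g a ⊔ b) + (g b ⊔ a)

minSplitCost : (ℕ → ℕ) → ℕ → ℕ
minSplitCost g m = minUpTo (λ a → splitCost g a (m ∸ a)) m

minSplitCost-≤ : ∀ g a b → minSplitCost g (a + b) ≤ splitCost g a b
minSplitCost-≤ g a b = subst (λ b′ → minSplitCost g (a + b) ≤ splitCost g a b′) (m+n∸m≡n a b)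
  (minUpTo-≤ (λ a′ → splitCost g a′ (a + b ∸ a′)) (a + b) (m≤m+n a b))

nbhdBound : ℕ → ℕ → ℕ → ℕ
nbhdBound w zero    = cacheUpTo w (1 ⊓_)
nbhdBound w (suc n) = cacheUpTo w (minSplitCost (nbhdBound w n))

nbhdBound-sound : ∀ w n (T : List (Subset n)) → Unique T → AtLeast (Near T) (nbhdBound w n (length T))
nbhdBound-sound w zero    []        _ = atLeast [] [] [] (cacheUpTo-≤ w _ 0)
nbhdBound-sound w zero    ([] ∷ T)  _ = atLeast ([] ∷ []) ([] ∷ []) (here z≤n ∷ []) (cacheUpTo-≤ w _ (suc (length T)))
nbhdBound-sound w (suc n) T         u = AtLeast-weaken bound≤cost (AtLeast-split (half true) (half false))
  where
  g : ℕ → ℕ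
  g = nbhdBound w n

  half : ∀ b → AtLeast (Near T ∘ (b ∷_)) (g (length (slice b T)) ⊔ length (slice (not b) T))
  half b = AtLeast-⊔ (AtLeast-map id id (slice-near b) (nbhdBound-sound w n (slice b T) (slice-unique b u)))
                     (atLeast (slice (not b) T) (slice-unique (not b) u) (All.tabulate (slice-not-near b)) ≤-refl)

  bound≤cost : nbhdBound w (suc n) (length T) ≤ splitCost g (length (slice true T)) (length (slice false T))
  bound≤cost = begin
    nbhdBound w (suc n) (length T)
      ≡⟨ cong (nbhdBound w (suc n)) (length-slices T) ⟩
    nbhdBound w (suc n) (length (slice true T) + length (slice false T))
      ≤⟨ cacheUpTo-≤ w (minSplitCost g) _ ⟩
    minSplitCost g (length (slice true T) + length (slice false T))
      ≤⟨ minSplitCost-≤ g (length (slice true T)) (length (slice false T)) ⟩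
    splitCost g (length (slice true T)) (length (slice false T)) ∎
    where open ≤-Reasoning

nbhdBound-20-in-Q₇ : nbhdBound 21 7 20 ≡ 57
nbhdBound-20-in-Q₇ = refl

-- Colourings whose classes have at most two elements

module Mates {V C : Set} (_≟_ : DecidableEquality V) (_≟ᶜ_ : DecidableEquality C)
             {vertices : List V} (complete : ∀ v → v ∈ vertices) (c : V → C)
             (no-triple : ∀ {x y z} → x ≢ y → y ≢ z → x ≢ z → c x ≡ c y → c y ≡ c z → ⊥) where

  Rival : V → V → Set
  Rival v w = w ≢ v × c w ≡ c v

  Alone : V → Set
  Alone v = ∀ w → c w ≡ c v → w ≡ v

  private
    pick : ∀ {v} → Dec (Any (Rival v) vertices) → V
    pick     (yes rival) = proj₁ (Any.satisfied rival)
    pick {v} (no  _)     = v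

    pick-spec : ∀ {v} (rival? : Dec (Any (Rival v) vertices)) → (pick rival? ≡ v × Alone v) ⊎ Rival v (pick rival?)
    pick-spec     (yes rival) = inj₂ (proj₂ (Any.satisfied rival))
    pick-spec {v} (no ¬rival) = inj₁ (refl , alone)
      where
      alone : Alone v
      alone w cw≡cv with w ≟ v
      ... | yes w≡v = w≡v
      ... | no  w≢v = ⊥-elim (¬rival (lose (complete w) (w≢v , cw≡cv)))

    rival? : ∀ v → Dec (Any (Rival v) vertices)
    rival? v = Any.any? (λ w → ¬? (w ≟ v) ×-dec (c w ≟ᶜ c v)) vertices

  -- Opaque: unfolding mate would normalise the search through all of V.
  opaque
    mate : V → V
    mate v = pick (rival? v)

    mate-spec : ∀ v → (mate v ≡ v × Alone v) ⊎ Rival v (mate v)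
    mate-spec v = pick-spec (rival? v)

  Lonely : V → Set
  Lonely v = mate v ≡ v

  mate-colour : ∀ v → c (mate v) ≡ c v
  mate-colour v with mate-spec v
  ... | inj₁ (m≡v , _)  = cong c m≡v
  ... | inj₂ (_ , cm≡cv) = cm≡cv

  lonely⇒alone : ∀ {v} → Lonely v → Alone v
  lonely⇒alone {v} m≡v with mate-spec v
  ... | inj₁ (_ , alone) = alone
  ... | inj₂ (m≢v , _)   = ⊥-elim (m≢v m≡v)

  same-colour⇒self-or-mate : ∀ {v w} → c w ≡ c v → w ≡ v ⊎ w ≡ mate v
  same-colour⇒self-or-mate {v} {w} cw≡cv with w ≟ v | mate-spec v
  ... | yes w≡v | _                = inj₁ w≡v
  ... | no  _   | inj₁ (_ , alone) = inj₁ (alone w cw≡cv)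
  ... | no  w≢v | inj₂ (m≢v , cm≡cv) with w ≟ mate v
  ...   | yes w≡m = inj₂ w≡m
  ...   | no  w≢m = ⊥-elim (no-triple w≢v (m≢v ∘ sym) w≢m cw≡cv (sym cm≡cv))

  mate-involutive : ∀ v → mate (mate v) ≡ v
  mate-involutive v with mate-spec v
  ... | inj₁ (m≡v , _) = trans (cong mate m≡v) m≡v
  ... | inj₂ (m≢v , cm≡cv) with same-colour⇒self-or-mate {mate v} {v} (sym cm≡cv)
  ...   | inj₁ v≡m  = ⊥-elim (m≢v (sym v≡m))
  ...   | inj₂ v≡mm = sym v≡mm

  mate-injective : Injective _≡_ _≡_ mate
  mate-injective {x} {y} mx≡my = begin
    x               ≡⟨ mate-involutive x ⟨
    mate (mate x)   ≡⟨ cong mate mx≡my ⟩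
    mate (mate y)   ≡⟨ mate-involutive y ⟩
    y               ∎
    where open ≡-Reasoning

-- b-colourings of cube powers

module BColouring {n p k} {c : Subset n → Fin k} (b-colouring : IsBColoring (QAdj n p) k c)
                  (sparse : 2 * n < 3 * suc p) where

  same-colour⇒far : ∀ {x y} → x ≢ y → c x ≡ c y → p < ∣ x △ y ∣
  same-colour⇒far {x} {y} x≢y cx≡cy with ∣ x △ y ∣ ≤? p
  ... | yes close = ⊥-elim (proj₁ b-colouring x y (x≢y , close) cx≡cy)
  ... | no  ¬close = ≰⇒> ¬close

  no-triple : ∀ {x y z} → x ≢ y → y ≢ z → x ≢ z → c x ≡ c y → c y ≡ c z → ⊥
  no-triple {x} {y} {z} x≢y y≢z x≢z cx≡cy cy≡cz = <⇒≱ sparse (begin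
    3 * suc p                              ≡⟨ thrice (suc p) ⟩
    suc p + suc p + suc p                  ≤⟨ +-mono-≤ (+-mono-≤ (same-colour⇒far x≢y cx≡cy) (same-colour⇒far y≢z cy≡cz))
                                                        (same-colour⇒far x≢z (trans cx≡cy cy≡cz)) ⟩
    ∣ x △ y ∣ + ∣ y △ z ∣ + ∣ x △ z ∣      ≤⟨ △-perimeter x y z ⟩
    2 * n                                  ∎)
    where
    open ≤-Reasoning

    thrice : ∀ q → 3 * q ≡ q + q + q
    thrice = solve-∀

  open Mates _≟ˢ_ Fin._≟_ ∈-allSubsets c no-triple public

  bvertex : Fin k → Subset n
  bvertex i = proj₁ (proj₂ b-colouring i)

  bvertex-colour : ∀ i → c (bvertex i) ≡ i
  bvertex-colour i = proj₁ (proj₂ (proj₂ b-colouring i))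

  bvertex-injective : Injective _≡_ _≡_ bvertex
  bvertex-injective {i} {j} bi≡bj = trans (sym (bvertex-colour i)) (trans (cong c bi≡bj) (bvertex-colour j))

  lonely⇒near-bvertex : ∀ {u} i → Lonely u → i ≢ c u → ∣ bvertex i △ u ∣ ≤ p
  lonely⇒near-bvertex {u} i lonely i≢cu with proj₂ (proj₂ (proj₂ b-colouring i)) (c u) (i≢cu ∘ sym)
  ... | w , (_ , close) , cw≡cu = subst (λ v → ∣ bvertex i △ v ∣ ≤ p) (lonely⇒alone lonely w cw≡cu) close

  IsBVertex : Subset n → Set
  IsBVertex v = bvertex (c v) ≡ v

  lonely? : Decidable (Lonely ∘ bvertex)
  lonely? i = mate (bvertex i) ≟ˢ bvertex i

  -- The k b-vertices and the mates of the N non-singleton ones are distinct, and L + N = k.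
  lonely-count : AtLeast Lonely (2 * k ∸ 2 ^ n)
  lonely-count = AtLeast-weaken (m≤n+o⇒m∸n≤o (2 * k) (2 ^ n) 2k≤2ⁿ+L) lonely-bvertices
    where
    L N : ℕ
    L = length (filter lonely? (allFin k))
    N = length (filter (∁? lonely?) (allFin k))

    lonely-colours : AtLeast (Lonely ∘ bvertex) L
    lonely-colours = AtLeast-filter lonely? (Unique.allFin⁺ k)

    shared-colours : AtLeast (¬_ ∘ Lonely ∘ bvertex) N
    shared-colours = AtLeast-filter (∁? lonely?) (Unique.allFin⁺ k)

    lonely-bvertices : AtLeast Lonely L
    lonely-bvertices = AtLeast-map bvertex bvertex-injective id lonely-colours

    bvertices : AtLeast IsBVertex (L + N)
    bvertices = AtLeast-map bvertex bvertex-injective (λ {i} _ → cong bvertex (bvertex-colour i))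
                  (AtLeast-∪ (λ lonely ¬lonely → ¬lonely lonely) lonely-colours shared-colours)

    mates : AtLeast (¬_ ∘ IsBVertex) N
    mates = AtLeast-map (mate ∘ bvertex) (bvertex-injective ∘ mate-injective) mate-not-bvertex shared-colours
      where
      mate-not-bvertex : ∀ {i} → ¬ Lonely (bvertex i) → ¬ IsBVertex (mate (bvertex i))
      mate-not-bvertex {i} ¬lonely is-bvertex =
        ¬lonely (trans (sym is-bvertex) (cong bvertex (trans (mate-colour _) (bvertex-colour i))))

    L+N≡k : L + N ≡ k
    L+N≡k = trans (length-filter+length-filter-∁ lonely? (allFin k)) (length-tabulate id)

    2k≤2ⁿ+L : 2 * k ≤ 2 ^ n + L
    2k≤2ⁿ+L = begin
      2 * k                ≡⟨ cong (2 *_) L+N≡k ⟨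
      2 * (L + N)          ≡⟨ regroup L N ⟩
      (L + N) + N + L      ≤⟨ +-monoˡ-≤ L (AtLeast⇒≤2^n (AtLeast-∪ (λ is ¬is → ¬is is) bvertices mates)) ⟩
      2 ^ n + L            ∎
      where
      open ≤-Reasoning

      regroup : ∀ l m → 2 * (l + m) ≡ (l + m) + m + l
      regroup = solve-∀

  Far : Subset n → Set
  Far y = Σ (Subset n) λ u → Lonely u × p < ∣ y △ u ∣

  far⇒not-bvertex : ∀ {y} → Far y → ¬ IsBVertex y
  far⇒not-bvertex {y} (u , lonely , far) is-bvertex with c y Fin.≟ c u
  ... | yes cy≡cu = n≮0 (subst (p <_) (△-self u) (subst (λ v → p < ∣ v △ u ∣) (lonely⇒alone lonely y cy≡cu) far))
  ... | no  cy≢cu = <⇒≱ far (subst (λ v → ∣ v △ u ∣ ≤ p) is-bvertex (lonely⇒near-bvertex (c y) lonely cy≢cu))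

  far⇒mate-bvertex : ∀ {y} → Far y → bvertex (c y) ≡ mate y
  far⇒mate-bvertex {y} far with same-colour⇒self-or-mate (bvertex-colour (c y))
  ... | inj₁ b≡y = ⊥-elim (far⇒not-bvertex far b≡y)
  ... | inj₂ b≡m = b≡m

  far⇒not-lonely : ∀ {y} → Far y → ¬ Lonely y
  far⇒not-lonely {y} far lonely = far⇒not-bvertex far (lonely⇒alone lonely _ (bvertex-colour (c y)))

  far⇒mate-not-far : ∀ {y} → Far y → ¬ Far (mate y)
  far⇒mate-not-far {y} far far-mate =
    far⇒not-bvertex far-mate (trans (cong bvertex (mate-colour y)) (far⇒mate-bvertex far))

  far⇒mate-not-lonely : ∀ {y} → Far y → ¬ Lonely (mate y)
  far⇒mate-not-lonely {y} far lonely-mate =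
    far⇒not-lonely far (sym (trans (sym (mate-involutive y)) lonely-mate))

  -- Lonely vertices, far vertices and the mates of far vertices are pairwise distinct.
  lonely-far-count : ∀ {a b} → AtLeast Lonely a → AtLeast Far b → a + (b + b) ≤ 2 ^ n
  lonely-far-count lonely far = AtLeast⇒≤2^n
    (AtLeast-∪ lonely-excl lonely (AtLeast-∪ (λ far (_ , ¬far) → ¬far far) far
      (AtLeast-map mate mate-injective (λ far → far⇒mate-not-lonely far , far⇒mate-not-far far) far)))
    where
    lonely-excl : ∀ {y} → Lonely y → Far y ⊎ (¬ Lonely y × ¬ Far y) → ⊥
    lonely-excl lonely (inj₁ far)         = far⇒not-lonely far lonely
    lonely-excl lonely (inj₂ (¬lonely , _)) = ¬lonely lonely

module _ {k} {c : Subset 7 → Fin k} (b-colouring : IsBColoring (QAdj 7 5) k c) where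

  open BColouring b-colouring (from-yes (2 * 7 <? 3 * 6))

  complement-near⇒far : ∀ {U} → All Lonely U → ∀ {y} → Near (map ∁ U) y → Far y
  complement-near⇒far lonely {y} near with All.lookupAny lonely (Any.map⁻ near)
  ... | lonely-u , y~∁u = _ , lonely-u , s≤s⁻¹ (∁-near⇒far y _ y~∁u)

  lonely-20⇒far-57 : AtLeast Lonely 20 → AtLeast Far 57
  lonely-20⇒far-57 (atLeast xs unique lonely size) =
    AtLeast-map id id (λ {y} → complement-near⇒far (All.take⁺ 20 lonely) {y})
      (subst (AtLeast (Near (map ∁ U))) bound≡57 (nbhdBound-sound 21 7 (map ∁ U) (Unique.map⁺ ∁-injective (Unique.take⁺ 20 unique))))
    where
    U : List (Subset 7)
    U = take 20 xs

    bound≡57 : nbhdBound 21 7 (length (map ∁ U)) ≡ 57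
    bound≡57 = trans (cong (nbhdBound 21 7) (trans (length-map ∁ U) (trans (length-take 20 xs) (m≤n⇒m⊓n≡m size))))
                     nbhdBound-20-in-Q₇

  colours≤73 : k ≤ 73
  colours≤73 with k ≤? 73
  ... | yes k≤73 = k≤73
  ... | no  k≰73 = ⊥-elim (<⇒≱ (from-yes (128 <? 134)) (lonely-far-count lonely-20 (lonely-20⇒far-57 lonely-20)))
    where
    lonely-20 : AtLeast Lonely 20
    lonely-20 = AtLeast-weaken (∸-monoˡ-≤ (2 ^ 7) (*-monoʳ-≤ 2 (≰⇒> k≰73))) lonely-count

lemma4p3 : bChromatic≤ (QAdj 7 5) (2 ^ 6 + 9)
lemma4p3 k c b-colouring = colours≤73 b-colouring
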